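{- If $b \in \{2, 3, 5, 7, 9\}$, then there are infinitely many triangular numbers which are palindromic in base $b$.
   Context: Triangular numbers are $t_n = \frac{n(n+1)}{2}$ for positive integers $n$. A positive integer $k$ with base-$b$ expansion $k = \sum_{i=0}^m a_i b^i$ ($0\le a_i\le b-1$, $a_m\neq 0$) is palindromic in base $b$ if $a_i = a_{m-i}$ for all $i = 0, 1, \dots, m$. -}

module Defs where

open import Data.Nat using (ℕ; zero; suc; _+_; _*_; _<_; _≤_; NonZero)
open import Data.Nat.DivMod using (_/_; _%_)
open import Data.List using (List; []; _∷_; reverse)
open import Data.Product using (_×_)
open import Relation.Binary.PropositionalEquality using (_≡_)

tri : ℕ → ℕ
tri n = (n * suc n) / 2

-- base-b digits, least significant first, computed with fuel.
-- With fuel ≥ k the result is the full expansion a_0, a_1, …, a_m of k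
-- (empty list for k = 0), since each step divides k by b ≥ 2.
digitsFuel : (b : ℕ) → .{{NonZero b}} → ℕ → ℕ → List ℕ
digitsFuel b zero    k       = []
digitsFuel b (suc f) zero    = []
digitsFuel b (suc f) (suc k) = (suc k % b) ∷ digitsFuel b f (suc k / b)

-- base-b digit list a_0 … a_m of k (a_m ≠ 0), used for b ≥ 2;
-- fuel k suffices since k has at most k digits.
digits : (b : ℕ) → .{{NonZero b}} → ℕ → List ℕ
digits b k = digitsFuel b k k

Palindromic : (b : ℕ) → .{{NonZero b}} → ℕ → Set
Palindromic b k = (0 < k) × (reverse (digits b k) ≡ digits b k)

module Submission where

-- A digit list (least significant digit first) whose digits are
-- below b and whose last digit is nonzero is exactly what 'digits b' returns
-- for its value, so a palindromic such list has a palindromic value.  Hence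
-- it suffices to exhibit, for each base, arbitrarily long palindromic digit
-- lists whose values are triangular.
--   * Odd base b = 2c+1: (mb+c)(mb+c+1) = m(m+1)b² + c(c+1), i.e.
--     t(mb+c) = t(m)·b² + t(c).  If t(c) has the two digits a z and
--     t(n₀) = a, iterating n ↦ nb+c produces triangular numbers with digits
--     a z a z … a.  This covers b = 3, 5, 7 (z = 0) and b = 9 (a = z = 1).
--   * Base 2: with p = 2^k, t(4p+1) = (2p+1)(4p+1), whose binary expansion
--     is u u for the palindrome u = 1 0^k 1.
-- The file first develops digit lists and their values, then the reduction
-- from palindromic lists to palindromic triangular numbers, then the two
-- families, and finally the theorem by case analysis on the base.

open import Defs
open import Data.Nat using (ℕ; zero; suc; _+_; _*_; _^_; _<_; _≤_; NonZero; >-nonZero; z≤n; s≤s; _<?_)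
open import Data.Nat.Properties
open import Data.Nat.DivMod
open import Data.Nat.Tactic.RingSolver using (solve)
open import Data.Empty using (⊥-elim)
open import Data.Product using (Σ; _×_; _,_)
open import Data.List using (List; []; _∷_; _++_; reverse; length; replicate)
open import Data.List.Properties using (reverse-++; unfold-reverse; length-++; length-++-≤ˡ; length-replicate)
open import Data.List.Relation.Unary.All as All using (All)
open import Data.List.Relation.Unary.All.Properties using (replicate⁺)
open import Data.List.Membership.Propositional using (_∈_)
open import Data.List.Relation.Unary.Any using (here; there)
open import Relation.Binary.PropositionalEquality
open import Relation.Nullary.Decidable using (True; toWitness)

IsPalindrome : List ℕ → Set
IsPalindrome xs = reverse xs ≡ xs

replicate-palindrome : ∀ k x → IsPalindrome (replicate k x)
replicate-palindrome zero    x = refl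
replicate-palindrome (suc k) x = begin
  reverse (x ∷ replicate k x)      ≡⟨ unfold-reverse x (replicate k x) ⟩
  reverse (replicate k x) ++ x ∷ [] ≡⟨ cong (_++ x ∷ []) (replicate-palindrome k x) ⟩
  replicate k x ++ x ∷ []           ≡⟨ snoc-replicate k ⟩
  x ∷ replicate k x                 ∎
  where
  open ≡-Reasoning
  snoc-replicate : ∀ k → replicate k x ++ x ∷ [] ≡ x ∷ replicate k x
  snoc-replicate zero    = refl
  snoc-replicate (suc k) = cong (x ∷_) (snoc-replicate k)

enclose-palindrome : ∀ x xs → IsPalindrome xs → IsPalindrome (x ∷ xs ++ x ∷ [])
enclose-palindrome x xs pal = begin
  reverse (x ∷ xs ++ x ∷ [])          ≡⟨ unfold-reverse x (xs ++ x ∷ []) ⟩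
  reverse (xs ++ x ∷ []) ++ x ∷ []    ≡⟨ cong (_++ x ∷ []) (reverse-++ xs (x ∷ [])) ⟩
  x ∷ reverse xs ++ x ∷ []            ≡⟨ cong (λ ys → x ∷ ys ++ x ∷ []) pal ⟩
  x ∷ xs ++ x ∷ []                    ∎
  where open ≡-Reasoning

double-palindrome : ∀ xs → IsPalindrome xs → IsPalindrome (xs ++ xs)
double-palindrome xs pal = trans (reverse-++ xs xs) (cong₂ _++_ pal pal)

value : ℕ → List ℕ → ℕ
value b []       = 0
value b (d ∷ ds) = d + value b ds * b

data Canonical (b : ℕ) : List ℕ → Set where
  leading : ∀ {d}    → d < b → 0 < d → Canonical b (d ∷ [])
  digit   : ∀ {d ds} → d < b → Canonical b ds → Canonical b (d ∷ ds)

canonical-digits : ∀ {b ds} → Canonical b ds → All (_< b) ds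
canonical-digits (leading d<b _) = d<b All.∷ All.[]
canonical-digits (digit d<b c)   = d<b All.∷ canonical-digits c

canonical-++ : ∀ {b ys} xs → All (_< b) xs → Canonical b ys → Canonical b (xs ++ ys)
canonical-++ []       All.[]           c = c
canonical-++ (x ∷ xs) (x<b All.∷ xs<b) c = digit x<b (canonical-++ xs xs<b c)

value-++ : ∀ b xs ys → value b (xs ++ ys) ≡ value b xs + value b ys * b ^ length xs
value-++ b []       ys = sym (trans (+-identityˡ _) (*-identityʳ _))
value-++ b (x ∷ xs) ys = begin
  x + value b (xs ++ ys) * b                          ≡⟨ cong (λ v → x + v * b) (value-++ b xs ys) ⟩
  x + (value b xs + value b ys * b ^ length xs) * b   ≡⟨ regroup (value b xs) (value b ys) (b ^ length xs) ⟩
  x + value b xs * b + value b ys * (b * b ^ length xs) ∎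
  where
  open ≡-Reasoning
  regroup : ∀ v w p → x + (v + w * p) * b ≡ x + v * b + w * (b * p)
  regroup v w p = solve (x ∷ v ∷ w ∷ p ∷ b ∷ [])

value-zeros : ∀ b k → value b (replicate k 0) ≡ 0
value-zeros b zero    = refl
value-zeros b (suc k) = cong (_* b) (value-zeros b k)

value-grows : ∀ {b v} d → 2 ≤ b → 0 < v → v < d + v * b
value-grows {b} {v} d b≥2 v>0 = <-≤-trans (m<m*n v b {{>-nonZero v>0}} b≥2) (m≤n+m (v * b) d)

value-positive : ∀ {b ds} → 2 ≤ b → Canonical b ds → 0 < value b ds
value-positive b≥2 (leading {d} _ d>0) = ≤-trans d>0 (m≤m+n d 0)
value-positive b≥2 (digit {d} _ c)     = <-trans (value-positive b≥2 c) (value-grows d b≥2 (value-positive b≥2 c))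

length-≤-value : ∀ {b ds} → 2 ≤ b → Canonical b ds → length ds ≤ value b ds
length-≤-value b≥2 c@(leading _ _) = value-positive b≥2 c
length-≤-value b≥2 (digit {d} _ c)  = ≤-trans (s≤s (length-≤-value b≥2 c)) (value-grows d b≥2 (value-positive b≥2 c))

module _ (b : ℕ) .{{_ : NonZero b}} where

  digit-mod : ∀ {d} v → d < b → (d + v * b) % b ≡ d
  digit-mod {d} v d<b = trans ([m+kn]%n≡m%n d v b) (m<n⇒m%n≡m d<b)

  digit-div : ∀ {d} v → d < b → (d + v * b) / b ≡ v
  digit-div {d} v d<b = begin
    (d + v * b) / b    ≡⟨ +-distrib-/ d (v * b) remainders<b ⟩
    d / b + v * b / b  ≡⟨ cong₂ _+_ (m<n⇒m/n≡0 d<b) (m*n/n≡m v b) ⟩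
    v                  ∎
    where
    open ≡-Reasoning
    remainders<b : d % b + v * b % b < b
    remainders<b = subst (_< b) (sym (trans (cong₂ _+_ (m<n⇒m%n≡m d<b) (m*n%n≡0 v b)) (+-identityʳ d))) d<b

  digitsFuel-digit : ∀ f {d} v → d < b → 0 < d + v * b → digitsFuel b (suc f) (d + v * b) ≡ d ∷ digitsFuel b f v
  digitsFuel-digit f {d} v d<b k>0 = begin
    digitsFuel b (suc f) k                 ≡⟨ step k k>0 ⟩
    k % b ∷ digitsFuel b f (k / b)         ≡⟨ cong₂ _∷_ (digit-mod v d<b) (cong (digitsFuel b f) (digit-div v d<b)) ⟩
    d ∷ digitsFuel b f v                   ∎
    where
    open ≡-Reasoning
    k : ℕ
    k = d + v * b
    step : ∀ k → 0 < k → digitsFuel b (suc f) k ≡ k % b ∷ digitsFuel b f (k / b)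
    step (suc k) _ = refl

  digitsFuel-zero : ∀ f → digitsFuel b f 0 ≡ []
  digitsFuel-zero zero    = refl
  digitsFuel-zero (suc f) = refl

  digitsFuel-value : 2 ≤ b → ∀ f {ds} → Canonical b ds → value b ds ≤ f → digitsFuel b f (value b ds) ≡ ds
  digitsFuel-value b≥2 zero c v≤0 = ⊥-elim (<⇒≱ (value-positive b≥2 c) v≤0)
  digitsFuel-value b≥2 (suc f) c@(leading {d} d<b _) _ =
    trans (digitsFuel-digit f 0 d<b (value-positive b≥2 c)) (cong (d ∷_) (digitsFuel-zero f))
  digitsFuel-value b≥2 (suc f) c@(digit {d} {ds} d<b c′) v≤1+f =
    trans (digitsFuel-digit f (value b ds) d<b (value-positive b≥2 c)) (cong (d ∷_) (digitsFuel-value b≥2 f c′ v≤f))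
    where
    v≤f : value b ds ≤ f
    v≤f = ≤-pred (≤-trans (value-grows d b≥2 (value-positive b≥2 c′)) v≤1+f)

  palindromic-value : 2 ≤ b → ∀ {ds} → Canonical b ds → IsPalindrome ds → Palindromic b (value b ds)
  palindromic-value b≥2 {ds} c pal =
    value-positive b≥2 c , trans (cong reverse digits≡ds) (trans pal (sym digits≡ds))
    where
    digits≡ds : digits b (value b ds) ≡ ds
    digits≡ds = digitsFuel-value b≥2 _ c ≤-refl

tri-from-double : ∀ n V → n * suc n ≡ V * 2 → tri n ≡ V
tri-from-double n V e = trans (cong (_/ 2) e) (m*n/n≡m V 2)

PalindromicTriangleAbove : (b : ℕ) → .{{_ : NonZero b}} → ℕ → Set
PalindromicTriangleAbove b N = Σ ℕ (λ n → (1 ≤ n) × (N < tri n) × Palindromic b (tri n))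

palindromic-triangle : ∀ b .{{_ : NonZero b}} → 2 ≤ b → ∀ {N} n {ds} → Canonical b ds → IsPalindrome ds →
  N < length ds → n * suc n ≡ value b ds * 2 → PalindromicTriangleAbove b N
palindromic-triangle b b≥2 {N} n {ds} c pal N<length tri-double =
  n , index-positive n N<tri , N<tri , subst (Palindromic b) (sym tri≡value) (palindromic-value b b≥2 c pal)
  where
  tri≡value : tri n ≡ value b ds
  tri≡value = tri-from-double n (value b ds) tri-double
  N<tri : N < tri n
  N<tri = <-≤-trans N<length (≤-trans (length-≤-value b≥2 c) (≤-reflexive (sym tri≡value)))
  -- t(0) = 0, so a triangular number above N has a positive index
  index-positive : ∀ n → N < tri n → 1 ≤ n
  index-positive (suc n) _ = s≤s z≤n

-- t(mb+c) = t(m)·b² + t(c) for b = 2c+1, in doubled form.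
odd-base-shift : ∀ c m → (m * suc (c + c) + c) * suc (m * suc (c + c) + c)
                       ≡ m * suc m * (suc (c + c) * suc (c + c)) + c * suc c
odd-base-shift c m = solve (m ∷ c ∷ [])

alternating : ℕ → ℕ → ℕ → List ℕ
alternating a z zero    = a ∷ []
alternating a z (suc k) = a ∷ z ∷ alternating a z k

alternating-palindrome : ∀ a z k → IsPalindrome (alternating a z k)
alternating-palindrome a z zero    = refl
alternating-palindrome a z (suc k) = begin
  reverse (a ∷ z ∷ alternating a z k)                 ≡⟨ reverse-++ (a ∷ z ∷ []) (alternating a z k) ⟩
  reverse (alternating a z k) ++ z ∷ a ∷ []           ≡⟨ cong (_++ z ∷ a ∷ []) (alternating-palindrome a z k) ⟩
  alternating a z k ++ z ∷ a ∷ []                     ≡⟨ snoc-alternating k ⟩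
  a ∷ z ∷ alternating a z k                           ∎
  where
  open ≡-Reasoning
  snoc-alternating : ∀ k → alternating a z k ++ z ∷ a ∷ [] ≡ a ∷ z ∷ alternating a z k
  snoc-alternating zero    = refl
  snoc-alternating (suc k) = cong (λ xs → a ∷ z ∷ xs) (snoc-alternating k)

alternating-canonical : ∀ {b a z} k → a < b → 0 < a → z < b → Canonical b (alternating a z k)
alternating-canonical zero    a<b a>0 z<b = leading a<b a>0
alternating-canonical (suc k) a<b a>0 z<b = digit a<b (digit z<b (alternating-canonical k a<b a>0 z<b))

alternating-length : ∀ a z k → k < length (alternating a z k)
alternating-length a z zero    = s≤s z≤n
alternating-length a z (suc k) = s≤s (m≤n⇒m≤1+n (alternating-length a z k))

odd-base-index : (c n₀ : ℕ) → ℕ → ℕ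
odd-base-index c n₀ zero    = n₀
odd-base-index c n₀ (suc k) = odd-base-index c n₀ k * suc (c + c) + c

odd-base-index-triangular : ∀ c a z n₀ → c * suc c ≡ (a + z * suc (c + c)) * 2 → n₀ * suc n₀ ≡ a * 2 →
  ∀ k → let n = odd-base-index c n₀ k in n * suc n ≡ value (suc (c + c)) (alternating a z k) * 2
odd-base-index-triangular c a z n₀ t-c t-n₀ zero = trans t-n₀ (cong (_* 2) (sym (+-identityʳ a)))
odd-base-index-triangular c a z n₀ t-c t-n₀ (suc k) = begin
  (m * b + c) * suc (m * b + c)           ≡⟨ odd-base-shift c m ⟩
  m * suc m * (b * b) + c * suc c         ≡⟨ cong₂ (λ x y → x * (b * b) + y) (odd-base-index-triangular c a z n₀ t-c t-n₀ k) t-c ⟩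
  V * 2 * (b * b) + (a + z * b) * 2       ≡⟨ carry V b ⟩
  (a + (z + V * b) * b) * 2               ∎
  where
  open ≡-Reasoning
  b m V : ℕ
  b = suc (c + c)
  m = odd-base-index c n₀ k
  V = value b (alternating a z k)
  carry : ∀ V b → V * 2 * (b * b) + (a + z * b) * 2 ≡ (a + (z + V * b) * b) * 2
  carry V b = solve (V ∷ b ∷ a ∷ z ∷ [])

odd-base-palindromic-triangles : ∀ c a z n₀ → 1 ≤ c → a < suc (c + c) → 0 < a → z < suc (c + c) →
  c * suc c ≡ (a + z * suc (c + c)) * 2 → n₀ * suc n₀ ≡ a * 2 →
  ∀ N → PalindromicTriangleAbove (suc (c + c)) N
odd-base-palindromic-triangles c a z n₀ c≥1 a<b a>0 z<b t-c t-n₀ N =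
  palindromic-triangle (suc (c + c)) (s≤s (≤-trans c≥1 (m≤m+n c c))) (odd-base-index c n₀ N)
    (alternating-canonical N a<b a>0 z<b) (alternating-palindrome a z N) (alternating-length a z N)
    (odd-base-index-triangular c a z n₀ t-c t-n₀ N)

binary-ends : ℕ → List ℕ
binary-ends k = 1 ∷ replicate k 0 ++ 1 ∷ []

binary-ends-palindrome : ∀ k → IsPalindrome (binary-ends k)
binary-ends-palindrome k = enclose-palindrome 1 (replicate k 0) (replicate-palindrome k 0)

binary-ends-canonical : ∀ k → Canonical 2 (binary-ends k)
binary-ends-canonical k =
  canonical-++ (1 ∷ replicate k 0) (s≤s (s≤s z≤n) All.∷ replicate⁺ k (s≤s z≤n)) (leading (s≤s (s≤s z≤n)) (s≤s z≤n))

binary-ends-length : ∀ k → length (binary-ends k) ≡ 2 + k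
binary-ends-length k = cong suc (trans (length-++ (replicate k 0)) (trans (cong (_+ 1) (length-replicate k)) (+-comm k 1)))

binary-ends-value : ∀ k → value 2 (binary-ends k) ≡ 1 + 2 ^ k * 2
binary-ends-value k = cong (λ v → 1 + v * 2) (begin
  value 2 (replicate k 0 ++ 1 ∷ [])                                  ≡⟨ value-++ 2 (replicate k 0) (1 ∷ []) ⟩
  value 2 (replicate k 0) + (1 + 0) * 2 ^ length (replicate k 0)     ≡⟨ cong₂ (λ v l → v + (1 + 0) * 2 ^ l) (value-zeros 2 k) (length-replicate k) ⟩
  (1 + 0) * 2 ^ k                                                    ≡⟨ *-identityˡ (2 ^ k) ⟩
  2 ^ k                                                              ∎)
  where open ≡-Reasoning

binary-index-triangular : ∀ k → let n = 2 ^ k * 4 + 1 in n * suc n ≡ value 2 (binary-ends k ++ binary-ends k) * 2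
binary-index-triangular k = begin
  (p * 4 + 1) * suc (p * 4 + 1)                    ≡⟨ factor p ⟩
  ((1 + p * 2) + (1 + p * 2) * (2 * (2 * p))) * 2  ≡⟨ cong (λ v → (v + v * (2 * (2 * p))) * 2) (sym (binary-ends-value k)) ⟩
  (u + u * (2 * (2 * p))) * 2                      ≡⟨ cong (λ l → (u + u * 2 ^ l) * 2) (sym (binary-ends-length k)) ⟩
  (u + u * 2 ^ length (binary-ends k)) * 2         ≡⟨ cong (_* 2) (sym (value-++ 2 (binary-ends k) (binary-ends k))) ⟩
  value 2 (binary-ends k ++ binary-ends k) * 2     ∎
  where
  open ≡-Reasoning
  p u : ℕ
  p = 2 ^ k
  u = value 2 (binary-ends k)
  factor : ∀ p → (p * 4 + 1) * suc (p * 4 + 1) ≡ ((1 + p * 2) + (1 + p * 2) * (2 * (2 * p))) * 2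
  factor p = solve (p ∷ [])

binary-palindromic-triangles : ∀ N → PalindromicTriangleAbove 2 N
binary-palindromic-triangles N =
  palindromic-triangle 2 ≤-refl (2 ^ N * 4 + 1)
    (canonical-++ (binary-ends N) (canonical-digits (binary-ends-canonical N)) (binary-ends-canonical N))
    (double-palindrome (binary-ends N) (binary-ends-palindrome N))
    (<-≤-trans N<length (length-++-≤ˡ (binary-ends N)))
    (binary-index-triangular N)
  where
  N<length : N < length (binary-ends N)
  N<length = subst (N <_) (sym (binary-ends-length N)) (<-trans (n<1+n N) (n<1+n (suc N)))

numeral< : ∀ {m n} → {True (m <? n)} → m < n
numeral< {m} {n} {m<n} = toWitness m<n

-- Bases 3, 5, 7 use t(c) = a with a = t(1), t(2), t(3) (so n₀ = c, z = 0);
-- base 9 uses t(4) = 10 = 1 + 1·9 and n₀ = 1.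
theorem3p2 : (b : ℕ) → .{{_ : NonZero b}} → b ∈ (2 ∷ 3 ∷ 5 ∷ 7 ∷ 9 ∷ []) →
    (N : ℕ) → Σ ℕ (λ n → (1 ≤ n) × (N < tri n) × Palindromic b (tri n))
theorem3p2 .2 (here refl)                                 = binary-palindromic-triangles
theorem3p2 .3 (there (here refl))                         = odd-base-palindromic-triangles 1 1 0 1 ≤-refl numeral< numeral< numeral< refl refl
theorem3p2 .5 (there (there (here refl)))                 = odd-base-palindromic-triangles 2 3 0 2 numeral< numeral< numeral< numeral< refl refl
theorem3p2 .7 (there (there (there (here refl))))         = odd-base-palindromic-triangles 3 6 0 3 numeral< numeral< numeral< numeral< refl refl
theorem3p2 .9 (there (there (there (there (here refl))))) = odd-base-palindromic-triangles 4 1 1 1 numeral< numeral< numeral< numeral< refl refl
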